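{- Let $n>5$ and let $\pi\in\mathcal{A}_n(1324,1423;213)$ have standard cycle form $(1,c_2,\dots,c_{r-1},2,c_{r+1},\dots,c_n)$ (so $c_r=2$). If $2<r<n$, then either $c_2<\cdots<c_{r-1}=n$, or $c_{r+1}<c_{r+2}<\cdots<c_n<c_{r-1}=c_n+1$; moreover, the case $c_{r-1}\neq n$ (so that only the second alternative holds) occurs only when $3<r<n$. If $r=n$, then $c_{r-1}=n$ or $c_{r-1}=3$. If $r=3$, then $c_2=n$.
   Context: A permutation $\pi$ of $[n]=\{1,\dots,n\}$ is cyclic if it consists of a single $n$-cycle. Its one-line notation is $\pi_1\pi_2\cdots\pi_n$ with $\pi_i=\pi(i)$. Its standard cycle form is $(c_1,c_2,\dots,c_n)$ with $c_1=1$ and $c_{i+1}=\pi(c_i)$ for $1\le i<n$. A sequence $w_1\cdots w_n$ of distinct integers contains a pattern $\sigma=\sigma_1\cdots\sigma_k\in S_k$ if there are indices $i_1<\dots<i_k$ with $w_{i_s}>w_{i_t}$ iff $\sigma_s>\sigma_t$ for all $s<t$; otherwise it avoids $\sigma$. $\mathcal{A}_n(\sigma_1,\dots,\sigma_l;\rho)$ is the set of cyclic permutations of $[n]$ whose one-line notation avoids each $\sigma_i$ and whose standard cycle form $c_1\cdots c_n$, read as a sequence, avoids $\rho$. -}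

module Defs where

open import Data.Nat using (ℕ; zero; suc; _∸_)
open import Data.Fin using (Fin; toℕ) renaming (zero to fzero; _<_ to _<ᶠ_)
open import Data.Fin.Permutation using (Permutation′; _⟨$⟩ʳ_)
open import Data.Vec using (Vec; []; _∷_; lookup)
open import Data.Product using (Σ; ∃-syntax; _×_)
open import Function.Bundles using (_⇔_)
open import Relation.Nullary using (¬_)
open import Relation.Binary.PropositionalEquality using (_≡_)
import Data.Nat as ℕ

Contains : ∀ {m k} → (Fin m → ℕ) → (Fin k → ℕ) → Set
Contains {m} {k} w σ =
  Σ (Fin k → Fin m) λ f →
    (∀ s t → s <ᶠ t → f s <ᶠ f t) ×
    (∀ s t → s <ᶠ t → ((w (f t) ℕ.< w (f s)) ⇔ (σ t ℕ.< σ s)))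

Avoids : ∀ {m k} → (Fin m → ℕ) → (Fin k → ℕ) → Set
Avoids w σ = ¬ Contains w σ

pat1324 pat1423 : Fin 4 → ℕ
pat1324 = lookup (1 ∷ 3 ∷ 2 ∷ 4 ∷ [])
pat1423 = lookup (1 ∷ 4 ∷ 2 ∷ 3 ∷ [])

pat213 : Fin 3 → ℕ
pat213 = lookup (2 ∷ 1 ∷ 3 ∷ [])

-- Permutations of [n] are permutations of Fin n; element i : Fin n stands for toℕ i + 1.
iter : ∀ {n} → Permutation′ n → ℕ → Fin n → Fin n
iter π zero    x = x
iter π (suc k) x = π ⟨$⟩ʳ (iter π k x)

oneLine : ∀ {n} → Permutation′ n → Fin n → ℕ
oneLine π i = suc (toℕ (π ⟨$⟩ʳ i))

Cyclic : ∀ {m} → Permutation′ (suc m) → Set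
Cyclic {m} π = ∀ (j : Fin (suc m)) → ∃[ k ] (iter π k fzero ≡ j)

-- Standard cycle form, 1-based index: c π i = c_i = π^{i-1}(1)  (for 1 ≤ i ≤ n).
c : ∀ {m} → Permutation′ (suc m) → ℕ → ℕ
c π i = suc (toℕ (iter π (i ∸ 1) fzero))

cycleWord : ∀ {m} → Permutation′ (suc m) → Fin (suc m) → ℕ
cycleWord π i = c π (suc (toℕ i))

InA : ∀ {m} → Permutation′ (suc m) → Set
InA π = Cyclic π × Avoids (oneLine π) pat1324 × Avoids (oneLine π) pat1423
        × Avoids (cycleWord π) pat213

{-# OPTIONS --safe #-}
-- As π(c_n) = 1 and π(c_{r-1}) = 2, the
-- one-line notation has 1 at position c_n and 2 at position c_{r-1}; a position strictly
-- between them, together with the later position n, would give 1324 or 1423.  Hence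
-- c_n < c_{r-1} < n forces c_{r-1} = c_n + 1, and for r = n (so c_n = 2) c_{r-1} is 3 or n.
-- In the cycle form, avoiding 213 puts every entry after 2 below c_{r-1}, and makes
-- every run of consecutive entries that ends in its own maximum increasing.
-- If c_{r-1} = n this gives the first alternative; otherwise c_n < c_{r-1}, so
-- c_{r-1} = c_n + 1 and the entries after 2 increase up to their maximum c_n.
-- For r = 3, an n after 2 would make (c₂, 2, n) a 213.
module Submission where

open import Defs
open import Data.Nat using (ℕ; zero; suc; _+_; _*_; _∸_; _<_; _≤_; z≤n; s≤s; s<s⁻¹; NonZero; >-nonZero)
open import Data.Nat.Properties
open import Data.Nat.DivMod using (_%_; _/_; m≡m%n+[m/n]*n; m%n<n)
open import Data.Fin using (Fin; toℕ; fromℕ<; fromℕ; inject₁) renaming (zero to fzero; suc to fsuc; _<_ to _<ᶠ_)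
open import Data.Fin.Patterns using (0F; 1F; 2F; 3F)
open import Data.Fin.Properties using (pigeonhole; toℕ-injective; toℕ-fromℕ<; toℕ-fromℕ; fromℕ<-injective; toℕ<n)
open import Data.Fin.Permutation using (Permutation′; _⟨$⟩ʳ_)
open import Data.Vec using (Vec; []; _∷_; lookup; map)
open import Data.Vec.Properties using (lookup-map)
open import Data.Product as Product using (_×_; _,_; proj₁; proj₂; ∃-syntax)
open import Data.Empty using (⊥; ⊥-elim)
open import Relation.Nullary using (¬_; yes; no)
open import Function using (_∘_; Injection)
open import Data.Sum as Sum using (_⊎_; inj₁; inj₂)
open import Function.Bundles using (mk⇔)
open import Function.Properties.Inverse using (↔⇒↣)
open import Relation.Binary using (_Preserves_⟶_; tri<; tri≈; tri>)
open import Relation.Binary.PropositionalEquality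

increasing-by-steps : ∀ {k} (g : Fin (suc k) → ℕ) →
  (∀ i → g (inject₁ i) < g (fsuc i)) → g Preserves _<ᶠ_ ⟶ _<_
increasing-by-steps g step {fzero} {fsuc fzero} _ = step fzero
increasing-by-steps {suc k} g step {fzero} {fsuc (fsuc t)} _ =
  <-trans (step fzero) (increasing-by-steps (g ∘ fsuc) (step ∘ fsuc) {fzero} {fsuc t} (s≤s z≤n))
increasing-by-steps {suc k} g step {fsuc s} {fsuc t} s<t =
  increasing-by-steps (g ∘ fsuc) (step ∘ fsuc) (s<s⁻¹ s<t)

increasing-reflects-< : ∀ {k} {g : Fin k → ℕ} → g Preserves _<ᶠ_ ⟶ _<_ →
  ∀ {s t} → g s < g t → s <ᶠ t
increasing-reflects-< {g = g} incr {s} {t} gs<gt with <-cmp (toℕ s) (toℕ t)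
... | tri< s<t _ _ = s<t
... | tri≈ _ s≡t _ = ⊥-elim (<-irrefl (cong g (toℕ-injective s≡t)) gs<gt)
... | tri> _ _ t<s = ⊥-elim (<-asym gs<gt (incr t<s))

-- A pattern is given by the 0-based ranks of its entries; pos r is the position
-- chosen for the entry of rank r, so pos ∘ lookup rank lists the positions left to right.
contains-by-ranks : ∀ {m k} (w : Fin m → ℕ) (rank : Vec (Fin (suc k)) (suc k)) (pos : Fin (suc k) → Fin m) →
  (∀ i → pos (lookup rank (inject₁ i)) <ᶠ pos (lookup rank (fsuc i))) →
  (∀ i → w (pos (inject₁ i)) < w (pos (fsuc i))) →
  Contains w (lookup (map (suc ∘ toℕ) rank))
contains-by-ranks w rank pos left-to-right by-value =
  pos ∘ lookup rank , (λ _ _ → increasing-by-steps (toℕ ∘ pos ∘ lookup rank) left-to-right) ,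
  λ s t _ → mk⇔
    (λ wt<ws → subst₂ _<_ (sym (lookup-map t _ rank)) (sym (lookup-map s _ rank))
                 (s≤s (increasing-reflects-< w∘pos-increasing wt<ws)))
    (λ σt<σs → w∘pos-increasing (s<s⁻¹ (subst₂ _<_ (lookup-map t _ rank) (lookup-map s _ rank) σt<σs)))
  where
  w∘pos-increasing : (w ∘ pos) Preserves _<ᶠ_ ⟶ _<_
  w∘pos-increasing = increasing-by-steps (w ∘ pos) by-value

module _ {m} (w : Fin m → ℕ) where

  contains-213 : ∀ {a b d} → a <ᶠ b → b <ᶠ d → w b < w a → w a < w d → Contains w pat213
  contains-213 {a} {b} {d} a<b b<d wb<wa wa<wd = contains-by-ranks w (1F ∷ 0F ∷ 2F ∷ []) (lookup (b ∷ a ∷ d ∷ []))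
    (λ { 0F → a<b ; 1F → b<d })
    (λ { 0F → wb<wa ; 1F → wa<wd })

  contains-1324 : ∀ {a b d e} → a <ᶠ b → b <ᶠ d → d <ᶠ e → w a < w d → w d < w b → w b < w e → Contains w pat1324
  contains-1324 {a} {b} {d} {e} a<b b<d d<e wa<wd wd<wb wb<we =
    contains-by-ranks w (0F ∷ 2F ∷ 1F ∷ 3F ∷ []) (lookup (a ∷ d ∷ b ∷ e ∷ []))
      (λ { 0F → a<b ; 1F → b<d ; 2F → d<e })
      (λ { 0F → wa<wd ; 1F → wd<wb ; 2F → wb<we })

  contains-1423 : ∀ {a b d e} → a <ᶠ b → b <ᶠ d → d <ᶠ e → w a < w d → w d < w e → w e < w b → Contains w pat1423
  contains-1423 {a} {b} {d} {e} a<b b<d d<e wa<wd wd<we we<wb =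
    contains-by-ranks w (0F ∷ 3F ∷ 1F ∷ 2F ∷ []) (lookup (a ∷ d ∷ e ∷ b ∷ []))
      (λ { 0F → a<b ; 1F → b<d ; 2F → d<e })
      (λ { 0F → wa<wd ; 1F → wd<we ; 2F → we<wb })

  avoids-1324-1423⇒¬1x2y : ∀ {a b d e} → Avoids w pat1324 → Avoids w pat1423 →
    a <ᶠ b → b <ᶠ d → d <ᶠ e → w a < w d → w d < w b → w d < w e → w b ≢ w e → ⊥
  avoids-1324-1423⇒¬1x2y {b = b} {e = e} av1324 av1423 a<b b<d d<e wa<wd wd<wb wd<we wb≢we with <-cmp (w b) (w e)
  ... | tri< wb<we _ _ = av1324 (contains-1324 a<b b<d d<e wa<wd wd<wb wb<we)
  ... | tri≈ _ wb≡we _ = wb≢we wb≡we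
  ... | tri> _ _ we<wb = av1423 (contains-1423 a<b b<d d<e wa<wd wd<we we<wb)

IncreasingOn : (ℕ → ℕ) → ℕ → ℕ → Set
IncreasingOn f lo hi = ∀ i j → lo ≤ i → i < j → j ≤ hi → f i < f j

module _ {n} (π : Permutation′ n) where

  iter-+ : ∀ a b x → iter π (a + b) x ≡ iter π a (iter π b x)
  iter-+ zero    b x = refl
  iter-+ (suc a) b x = cong (π ⟨$⟩ʳ_) (iter-+ a b x)

  iter-cancelˡ : ∀ a b x → iter π (a + b) x ≡ iter π a x → iter π b x ≡ x
  iter-cancelˡ zero    b x eq = eq
  iter-cancelˡ (suc a) b x eq = iter-cancelˡ a b x (Injection.injective (↔⇒↣ π) eq)

  iter-return : ∀ {a b} x → a ≤ b → iter π a x ≡ iter π b x → iter π (b ∸ a) x ≡ x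
  iter-return {a} {b} x a≤b eq =
    iter-cancelˡ a (b ∸ a) x (trans (cong (λ k → iter π k x) (m+[n∸m]≡n a≤b)) (sym eq))

  iter-periodic : ∀ p .{{_ : NonZero p}} x → iter π p x ≡ x → ∀ k → iter π k x ≡ iter π (k % p) x
  iter-periodic p x period k = begin
    iter π k x                               ≡⟨ cong (λ j → iter π j x) (m≡m%n+[m/n]*n k p) ⟩
    iter π (k % p + (k / p) * p) x           ≡⟨ iter-+ (k % p) _ x ⟩
    iter π (k % p) (iter π ((k / p) * p) x)  ≡⟨ cong (iter π (k % p)) (multiple (k / p)) ⟩
    iter π (k % p) x                         ∎
    where
    open ≡-Reasoning
    multiple : ∀ q → iter π (q * p) x ≡ x
    multiple zero    = refl
    multiple (suc q) = trans (iter-+ p (q * p) x) (trans (cong (iter π p) (multiple q)) period)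

module Orbit {m} (π : Permutation′ (suc m)) (cyclic : Cyclic π) where

  -- c₀ k = c_{k+1} − 1: index and value are both 0-based.
  c₀ : ℕ → ℕ
  c₀ k = toℕ (iter π k fzero)

  c₀<n : ∀ k → c₀ k < suc m
  c₀<n k = toℕ<n (iter π k fzero)

  period-≥n : ∀ {p} → 0 < p → iter π p fzero ≡ fzero → suc m ≤ p
  period-≥n {p} 0<p period = ≮⇒≥ too-short
    where
    instance
      p≢0 : NonZero p
      p≢0 = >-nonZero 0<p
    exponent : Fin (suc m) → ℕ
    exponent j = proj₁ (cyclic j)
    residue : Fin (suc m) → Fin p
    residue j = fromℕ< (m%n<n (exponent j) p)
    reached-by-residue : ∀ j → iter π (exponent j % p) fzero ≡ j
    reached-by-residue j = trans (sym (iter-periodic π p fzero period (exponent j))) (proj₂ (cyclic j))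
    too-short : ¬ p < suc m
    too-short p<n with i , j , i<j , same ← pigeonhole p<n residue =
      <-irrefl (cong toℕ (trans (sym (reached-by-residue i))
        (trans (cong (λ k → iter π k fzero) (fromℕ<-injective _ _ _ _ same)) (reached-by-residue j)))) i<j

  orbit-distinct : ∀ {a b} → a < b → b < suc m → c₀ a ≢ c₀ b
  orbit-distinct {a} {b} a<b b<n same = <-irrefl refl (≤-<-trans (≤-trans n≤b∸a (m∸n≤m b a)) b<n)
    where
    n≤b∸a : suc m ≤ b ∸ a
    n≤b∸a = period-≥n (m<n⇒0<n∸m a<b) (iter-return π fzero (<⇒≤ a<b) (toℕ-injective same))

  c₀-injective : ∀ {a b} → a < suc m → b < suc m → c₀ a ≡ c₀ b → a ≡ b
  c₀-injective {a} {b} a<n b<n same with <-cmp a b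
  ... | tri< a<b _ _ = ⊥-elim (orbit-distinct a<b b<n same)
  ... | tri≈ _ a≡b _ = a≡b
  ... | tri> _ _ b<a = ⊥-elim (orbit-distinct b<a a<n (sym same))

  orbit-closes : iter π (suc m) fzero ≡ fzero
  orbit-closes with i , j , i<j , same ← pigeonhole (n<1+n (suc m)) (λ i → iter π (toℕ i) fzero) =
    subst (λ k → iter π k fzero ≡ fzero) (≤-antisym (≤-trans (m∸n≤m (toℕ j) (toℕ i)) j≤n) n≤j∸i) returns
    where
    returns = iter-return π fzero (<⇒≤ i<j) same
    n≤j∸i = period-≥n (m<n⇒0<n∸m i<j) returns
    j≤n = m<1+n⇒m≤n (toℕ<n j)

  c₀-surjective : ∀ {v} → v < suc m → ∃[ k ] (k < suc m × c₀ k ≡ v)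
  c₀-surjective {v} v<n with k , reaches ← cyclic (fromℕ< v<n) =
    k % suc m , m%n<n k (suc m) ,
    trans (cong toℕ (trans (sym (iter-periodic π (suc m) fzero orbit-closes k)) reaches)) (toℕ-fromℕ< v<n)

  c₀≤m : ∀ k → c₀ k ≤ m
  c₀≤m k = m<1+n⇒m≤n (c₀<n k)

  c₀-<-of-≤ : ∀ {i h} → i < suc m → h < suc m → i ≢ h → c₀ i ≤ c₀ h → c₀ i < c₀ h
  c₀-<-of-≤ i<n h<n i≢h cᵢ≤cₕ = ≤∧≢⇒< cᵢ≤cₕ (i≢h ∘ c₀-injective i<n h<n)

  c-increasing : ∀ {lo hi} → IncreasingOn c₀ lo hi → IncreasingOn (c π) (suc lo) (suc hi)
  c-increasing inc zero    _       ()        _         _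
  c-increasing inc (suc i) zero    _         ()        _
  c-increasing inc (suc i) (suc j) (s≤s lo≤i) (s≤s i<j) (s≤s j≤hi) = s≤s (inc i j lo≤i i<j j≤hi)

module Avoiding {m} (π : Permutation′ (suc m)) (cyclic : Cyclic π)
  (av1324 : Avoids (oneLine π) pat1324) (av1423 : Avoids (oneLine π) pat1423)
  (av213 : Avoids (cycleWord π) pat213) where

  open Orbit π cyclic public

  private
    π-injective : ∀ {x y} → π ⟨$⟩ʳ x ≡ π ⟨$⟩ʳ y → x ≡ y
    π-injective = Injection.injective (↔⇒↣ π)

    index : ∀ {k} → k < suc m → ∃[ i ] (toℕ i ≡ k)
    index k<n = fromℕ< k<n , toℕ-fromℕ< k<n

  no-213 : ∀ {a b d} → a < b → b < d → d < suc m → c₀ b < c₀ a → c₀ a < c₀ d → ⊥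
  no-213 a<b b<d d<n
    with _ , refl ← index (<-trans a<b (<-trans b<d d<n))
       | _ , refl ← index (<-trans b<d d<n)
       | _ , refl ← index d<n
    = λ cb<ca ca<cd → av213 (contains-213 (cycleWord π) a<b b<d (s≤s cb<ca) (s≤s ca<cd))

  after-descent-below : ∀ {s i} → c₀ (suc s) < c₀ s → suc s < i → i < suc m → c₀ i < c₀ s
  after-descent-below {s} {i} descent s+1<i i<n with <-cmp (c₀ i) (c₀ s)
  ... | tri< cᵢ<cₛ _ _ = cᵢ<cₛ
  ... | tri≈ _ cᵢ≡cₛ _ = ⊥-elim (orbit-distinct (<-trans (n<1+n s) s+1<i) i<n (sym cᵢ≡cₛ))
  ... | tri> _ _ cₛ<cᵢ = ⊥-elim (no-213 (n<1+n s) s+1<i i<n descent cₛ<cᵢ)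

  increasing-below-peak : ∀ {lo hi} → hi < suc m → (∀ i → lo ≤ i → i < hi → c₀ i < c₀ hi) →
    IncreasingOn c₀ lo hi
  increasing-below-peak hi<n below i j lo≤i i<j j≤hi with <-cmp (c₀ i) (c₀ j)
  ... | tri< cᵢ<cⱼ _ _ = cᵢ<cⱼ
  ... | tri≈ _ cᵢ≡cⱼ _ = ⊥-elim (orbit-distinct i<j (≤-<-trans j≤hi hi<n) cᵢ≡cⱼ)
  ... | tri> _ _ cⱼ<cᵢ with m≤n⇒m<n∨m≡n j≤hi
  ...   | inj₁ j<hi = ⊥-elim (no-213 i<j j<hi hi<n cⱼ<cᵢ (below i lo≤i (<-trans i<j j<hi)))
  ...   | inj₂ refl = ⊥-elim (<-asym cⱼ<cᵢ (below i lo≤i i<j))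

  increasing-before-max : ∀ {lo s} → s < suc m → c₀ s ≡ m → IncreasingOn c₀ lo s
  increasing-before-max {s = s} s<n cₛ≡m = increasing-below-peak s<n λ i _ i<s →
    c₀-<-of-≤ (<-trans i<s s<n) s<n (<⇒≢ i<s) (subst (c₀ i ≤_) (sym cₛ≡m) (c₀≤m i))

  -- In one-line notation 1 sits at position c₀ m and 2 at position c₀ s.
  one-line-no-1x2y : ∀ {s} → c₀ (suc s) ≡ 1 → (q₂ q₄ : Fin (suc m)) →
    c₀ m < toℕ q₂ → toℕ q₂ < c₀ s → c₀ s < toℕ q₄ → ⊥
  one-line-no-1x2y {s} cₛ₊₁≡1 q₂ q₄ m<q₂ q₂<s s<q₄ =
    avoids-1324-1423⇒¬1x2y (oneLine π) {iter π m fzero} {q₂} {iter π s fzero} {q₄}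
      av1324 av1423 m<q₂ q₂<s s<q₄
      (subst₂ _<_ (sym one-at-last) (sym two-at-s) ≤-refl)
      (above-two q₂ (<⇒≢ m<q₂ ∘ sym) (<⇒≢ q₂<s))
      (above-two q₄ (<⇒≢ (<-trans m<q₂ (<-trans q₂<s s<q₄)) ∘ sym) (<⇒≢ s<q₄ ∘ sym))
      (<⇒≢ (<-trans q₂<s s<q₄) ∘ cong toℕ ∘ π-injective ∘ toℕ-injective ∘ suc-injective)
    where
    one-at-last : oneLine π (iter π m fzero) ≡ 1
    one-at-last = cong (suc ∘ toℕ) orbit-closes
    two-at-s : oneLine π (iter π s fzero) ≡ 2
    two-at-s = cong suc cₛ₊₁≡1
    value-≥2 : ∀ q → toℕ q ≢ c₀ m → toℕ q ≢ c₀ s → 2 ≤ toℕ (π ⟨$⟩ʳ q)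
    value-≥2 q q≢last q≢s with toℕ (π ⟨$⟩ʳ q) in πq
    ... | 0 = ⊥-elim (q≢last (cong toℕ (π-injective (toℕ-injective (trans πq (sym (cong toℕ orbit-closes)))))))
    ... | 1 = ⊥-elim (q≢s (cong toℕ (π-injective (toℕ-injective (trans πq (sym cₛ₊₁≡1))))))
    ... | suc (suc _) = s≤s (s≤s z≤n)
    above-two : ∀ q → toℕ q ≢ c₀ m → toℕ q ≢ c₀ s → oneLine π (iter π s fzero) < oneLine π q
    above-two q q≢last q≢s = subst (_< oneLine π q) (sym two-at-s) (s≤s (value-≥2 q q≢last q≢s))

  no-gap-below-predecessor-of-1 : ∀ {s} → c₀ (suc s) ≡ 1 → suc (c₀ m) < c₀ s → c₀ s < m → ⊥
  no-gap-below-predecessor-of-1 {s} cₛ₊₁≡1 gap s<m =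
    one-line-no-1x2y {s} cₛ₊₁≡1 (fromℕ< cₘ+1<n) (fromℕ m)
      (subst (c₀ m <_) (sym (toℕ-fromℕ< cₘ+1<n)) (n<1+n (c₀ m)))
      (subst (_< c₀ s) (sym (toℕ-fromℕ< cₘ+1<n)) gap)
      (subst (c₀ s <_) (sym (toℕ-fromℕ m)) s<m)
    where
    cₘ+1<n : suc (c₀ m) < suc m
    cₘ+1<n = <-trans gap (c₀<n s)

  predecessor-of-1-≥2 : ∀ {s} → 1 ≤ s → suc s < suc m → c₀ (suc s) ≡ 1 → 2 ≤ c₀ s
  predecessor-of-1-≥2 {s} 1≤s s+1<n cₛ₊₁≡1 = ≤∧≢⇒< (n≢0⇒n>0 cₛ≢0) (cₛ≢1 ∘ sym)
    where
    s<n : s < suc m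
    s<n = <-trans (n<1+n s) s+1<n
    cₛ≢0 : c₀ s ≢ 0
    cₛ≢0 cₛ≡0 = <-irrefl (sym (c₀-injective s<n (s≤s z≤n) cₛ≡0)) 1≤s
    cₛ≢1 : c₀ s ≢ 1
    cₛ≢1 cₛ≡1 = <-irrefl (c₀-injective s<n s+1<n (trans cₛ≡1 (sym cₛ₊₁≡1))) (n<1+n s)

  predecessor-of-1-at-end : ∀ {s} → 1 ≤ s → suc s ≡ m → c₀ (suc s) ≡ 1 → c₀ s ≡ m ⊎ c₀ s ≡ 2
  predecessor-of-1-at-end {s} 1≤s s+1≡m cₛ₊₁≡1 with m≤n⇒m<n∨m≡n (c₀≤m s)
  ... | inj₂ cₛ≡m = inj₁ cₛ≡m
  ... | inj₁ cₛ<m with m≤n⇒m<n∨m≡n (predecessor-of-1-≥2 1≤s s+1<n cₛ₊₁≡1)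
    where s+1<n = subst (_< suc m) (sym s+1≡m) (n<1+n m)
  ...   | inj₂ 2≡cₛ = inj₂ (sym 2≡cₛ)
  ...   | inj₁ 2<cₛ = ⊥-elim (no-gap-below-predecessor-of-1 {s} cₛ₊₁≡1 (subst (λ v → suc v < c₀ s) (sym cₘ≡1) 2<cₛ) cₛ<m)
    where cₘ≡1 = trans (cong c₀ (sym s+1≡m)) cₛ₊₁≡1

  predecessor-of-1-is-max-at-start : 2 ≤ m → c₀ 2 ≡ 1 → c₀ 1 ≡ m
  predecessor-of-1-is-max-at-start 2≤m c₂≡1 with c₀-surjective (n<1+n m)
  ... | 0 , _ , 0≡m = ⊥-elim (<-irrefl 0≡m (≤-trans (s≤s z≤n) 2≤m))
  ... | 1 , _ , c₁≡m = c₁≡m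
  ... | 2 , _ , c₂≡m = ⊥-elim (<-irrefl (trans (sym c₂≡1) c₂≡m) 2≤m)
  ... | suc (suc (suc k)) , k<n , cₖ≡m = ≤-antisym (c₀≤m 1) (≮⇒≥ λ c₁<m →
        no-213 (n<1+n 1) (s≤s (s≤s (s≤s z≤n))) k<n descent (subst (c₀ 1 <_) (sym cₖ≡m) c₁<m))
    where
    descent : c₀ 2 < c₀ 1
    descent = subst (_< c₀ 1) (sym c₂≡1) (predecessor-of-1-≥2 ≤-refl (s≤s 2≤m) c₂≡1)

  predecessor-of-1-not-max⇒2≤s : ∀ {s} → 2 ≤ m → 1 ≤ s → c₀ (suc s) ≡ 1 → c₀ s ≢ m → 2 ≤ s
  predecessor-of-1-not-max⇒2≤s {1} 2≤m _ c₂≡1 c₁≢m = ⊥-elim (c₁≢m (predecessor-of-1-is-max-at-start 2≤m c₂≡1))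
  predecessor-of-1-not-max⇒2≤s {suc (suc s)} _ _ _ _ = s≤s (s≤s z≤n)

  predecessor-of-1-not-max : ∀ {s} → 1 ≤ s → suc s < m → c₀ (suc s) ≡ 1 → c₀ s ≢ m →
    IncreasingOn c₀ (suc s + 1) m × c₀ m < c₀ s × c₀ s ≡ suc (c₀ m)
  predecessor-of-1-not-max {s} 1≤s s+1<m cₛ₊₁≡1 cₛ≢m =
    increasing-below-peak (n<1+n m) below-last , last<s , s≡last+1
    where
    descent : c₀ (suc s) < c₀ s
    descent = subst (_< c₀ s) (sym cₛ₊₁≡1) (predecessor-of-1-≥2 1≤s (<-trans s+1<m (n<1+n m)) cₛ₊₁≡1)
    last<s : c₀ m < c₀ s
    last<s = after-descent-below descent s+1<m (n<1+n m)
    s≡last+1 : c₀ s ≡ suc (c₀ m)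
    s≡last+1 with m≤n⇒m<n∨m≡n last<s
    ... | inj₁ gap = ⊥-elim (no-gap-below-predecessor-of-1 {s} cₛ₊₁≡1 gap (≤∧≢⇒< (c₀≤m s) cₛ≢m))
    ... | inj₂ eq  = sym eq
    below-last : ∀ i → suc s + 1 ≤ i → i < m → c₀ i < c₀ m
    below-last i s+2≤i i<m = c₀-<-of-≤ (<-trans i<m (n<1+n m)) (n<1+n m) (<⇒≢ i<m)
      (m<1+n⇒m≤n (subst (c₀ i <_) s≡last+1
        (after-descent-below descent (subst (_≤ i) (cong suc (+-comm s 1)) s+2≤i) (<-trans i<m (n<1+n m)))))

  predecessor-of-1-split : ∀ {s} → 1 ≤ s → suc s < m → c₀ (suc s) ≡ 1 →
    (IncreasingOn c₀ 1 s × c₀ s ≡ m) ⊎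
    (IncreasingOn c₀ (suc s + 1) m × c₀ m < c₀ s × c₀ s ≡ suc (c₀ m))
  predecessor-of-1-split {s} 1≤s s+1<m cₛ₊₁≡1 with c₀ s ≟ m
  ... | yes cₛ≡m = inj₁ (increasing-before-max (<-trans (n<1+n s) (<-trans s+1<m (n<1+n m))) cₛ≡m , cₛ≡m)
  ... | no cₛ≢m  = inj₂ (predecessor-of-1-not-max 1≤s s+1<m cₛ₊₁≡1 cₛ≢m)

lemma4p1 : ∀ (m : ℕ) → 5 < suc m → (π : Permutation′ (suc m)) → InA π →
    ∀ (r : ℕ) → 1 ≤ r → r ≤ suc m → c π r ≡ 2 →
      ((2 < r → r < suc m →
          (((∀ i j → 2 ≤ i → i < j → j ≤ r ∸ 1 → c π i < c π j) × c π (r ∸ 1) ≡ suc m)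
           ⊎ ((∀ i j → r + 1 ≤ i → i < j → j ≤ suc m → c π i < c π j)
              × c π (suc m) < c π (r ∸ 1) × c π (r ∸ 1) ≡ c π (suc m) + 1))
          × (¬ (c π (r ∸ 1) ≡ suc m) → 3 < r))
       × (r ≡ suc m → c π (r ∸ 1) ≡ suc m ⊎ c π (r ∸ 1) ≡ 3)
       × (r ≡ 3 → c π 2 ≡ suc m))
lemma4p1 _ _ _ _ zero () _ _
lemma4p1 _ _ _ _ (suc zero) _ _ ()
lemma4p1 m 5<n _ _ (suc (suc zero)) _ _ _ =
  (λ 2<2 → ⊥-elim (<-irrefl refl 2<2)) , (λ 2≡n → ⊥-elim (<-irrefl 2≡n 2<n)) , λ ()
  where
  2<n : 2 < suc m
  2<n = ≤-trans (s≤s (s≤s (s≤s z≤n))) 5<n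
lemma4p1 m 5<n π (cyclic , av1324 , av1423 , av213) (suc (suc s@(suc _))) _ _ cᵣ≡2 =
  (λ _ r<n →
    Sum.map (Product.map c-increasing (cong suc))
            (Product.map c-increasing (Product.map s≤s λ cₛ≡cₘ+1 → trans (cong suc cₛ≡cₘ+1) (+-comm 1 _)))
            (predecessor-of-1-split 1≤s (s<s⁻¹ r<n) cₛ₊₁≡1) ,
    λ cᵣ₋₁≢n → s≤s (s≤s (predecessor-of-1-not-max⇒2≤s 2≤m 1≤s cₛ₊₁≡1 (cᵣ₋₁≢n ∘ cong suc)))) ,
  (λ r≡n → Sum.map (cong suc) (cong suc) (predecessor-of-1-at-end 1≤s (suc-injective r≡n) cₛ₊₁≡1)) ,
  (λ r≡3 → cong suc (predecessor-of-1-is-max-at-start 2≤m (subst (λ k → c₀ k ≡ 1) (suc-injective r≡3) cₛ₊₁≡1)))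
  where
  open Avoiding π cyclic av1324 av1423 av213
  1≤s : 1 ≤ s
  1≤s = s≤s z≤n
  2≤m : 2 ≤ m
  2≤m = ≤-trans (s≤s (s≤s z≤n)) (s<s⁻¹ 5<n)
  cₛ₊₁≡1 : c₀ (suc s) ≡ 1
  cₛ₊₁≡1 = suc-injective cᵣ≡2
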